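{- Let $2\le k<g$ be integers. If, in $Y(g,k)$, a node $[r,s]$ directly precedes $[0,0]$ and is not an odd pivot node, then $(k+1)\mid g$.
   Context: For integers $2\le k<g$, the labeled directed graph $H(g,k)$ has a distinguished starting node $[[0,0]]$ and other nodes labeled by pairs $[R,r]$ of integers with $0\le R,r\le k-1$ (the node $[0,0]$ is distinct from the starting node). For a node $[P,p]$ (the starting node treated as $[0,0]$ here) there is an edge labeled $(A,a)$ from $[P,p]$ to $[R,r]$ whenever $0\le A,a\le g-1$ are integers, $0\le R,r\le k-1$, $ka+p=A+rg$ and $kA+R=a+Pg$; edges leaving the starting node additionally require $A\ne0\ne a$; no edge enters the starting node. $H(g,k)$ consists of the starting node and all nodes reachable from it. An even pivot node is a node $[a,a]$; an odd pivot node is a node $[r,s]$ with an edge to $[s,r]$ (including $[a,a]$ with a self-loop); the starting node is not a pivot node. $Y(g,k)$ is obtained from $H(g,k)$ by deleting every node that is not a pivot node and from which no pivot node is reachable, with incident edges. -}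

module Defs where

open import Data.Nat using (ℕ; _+_; _*_; _<_)
open import Data.Product using (Σ; ∃; ∃-syntax; _×_)
open import Data.Sum using (_⊎_)
open import Data.Empty using (⊥)
open import Relation.Nullary using (¬_)
open import Relation.Binary.PropositionalEquality using (_≡_; _≢_)
open import Relation.Binary.Construct.Closure.ReflexiveTransitive using (Star)

-- Nodes of H(g,k): the distinguished starting node [[0,0]], and ordinary
-- nodes [R,r] (the bounds 0 ≤ R,r ≤ k-1 are enforced by the edge relation).
data Node : Set where
  start : Node
  ⟦_,_⟧ : ℕ → ℕ → Node

-- Edge labeled (A,a) from [P,p] to [R,r] (starting node treated as [0,0],
-- with the extra requirement A ≠ 0 ≠ a).  No edge enters the starting node.
data Edge (g k : ℕ) : Node → Node → Set where
  fromStart : ∀ {R r} A a → A < g → a < g → R < k → r < k →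
              A ≢ 0 → a ≢ 0 →
              k * a + 0 ≡ A + r * g → k * A + R ≡ a + 0 * g →
              Edge g k start ⟦ R , r ⟧
  fromNode  : ∀ {P p R r} A a → A < g → a < g →
              P < k → p < k → R < k → r < k →
              k * a + p ≡ A + r * g → k * A + R ≡ a + P * g →
              Edge g k ⟦ P , p ⟧ ⟦ R , r ⟧

Reach : ℕ → ℕ → Node → Node → Set
Reach g k = Star (Edge g k)

InH : ℕ → ℕ → Node → Set
InH g k n = Reach g k start n

EvenPivot : Node → Set
EvenPivot start = ⊥
EvenPivot ⟦ a , b ⟧ = a ≡ b

OddPivot : ℕ → ℕ → Node → Set
OddPivot g k start = ⊥
OddPivot g k ⟦ r , s ⟧ = Edge g k ⟦ r , s ⟧ ⟦ s , r ⟧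

Pivot : ℕ → ℕ → Node → Set
Pivot g k n = EvenPivot n ⊎ OddPivot g k n

InY : ℕ → ℕ → Node → Set
InY g k n = InH g k n × (Pivot g k n ⊎ ∃[ m ] (Pivot g k m × Reach g k n m))

EdgeY : ℕ → ℕ → Node → Node → Set
EdgeY g k n m = InY g k n × InY g k m × Edge g k n m

module Submission where

-- Let [r,s] → [0,0] be an edge of Y(g,k) with label (A,a).  Its two edge
-- equations read  A = k a + s  and  k A = a + r g.  Put T = A + a.
--
--   * If T < g, then (T,T) is a legal label and summing the two equations
--     gives  k T + s = T + r g,  which is simultaneously both edge equations
--     of an edge [r,s] → [s,r]; so [r,s] would be an odd pivot node.
--   * If T ≥ g, then  k A + A = r g + T ≤ r T + T ≤ k T = k A + k a  (as r < k),
--     so A ≤ k a, which forces s = 0 and A = k a.  Now every inequality in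
--     the chain is an equality; since k ≥ 2 this pins down r = k - 1 ≥ 1 and
--     g = T = (k + 1) a.

open import Defs
open import Data.Nat using (ℕ; _+_; _≤_; _<_)
open import Data.Nat.Divisibility using (_∣_)
open import Relation.Nullary using (¬_)

open import Data.Nat using (_*_; suc; z<s; _≤?_; ≢-nonZero; >-nonZero)
open import Data.Nat.Properties
open import Data.Nat.Divisibility using (divides)
open import Data.Product using (_,_)
open import Data.Sum using (_⊎_; inj₁; inj₂; [_,_]′)
open import Data.Empty using (⊥-elim)
open import Relation.Nullary using (yes; no)
open import Relation.Binary.PropositionalEquality
open import Data.Nat.Tactic.RingSolver using (solve-∀)

swap-edge : ∀ {g k r s T} → T < g → r < k → s < k →
            k * T + s ≡ T + r * g → Edge g k ⟦ r , s ⟧ ⟦ s , r ⟧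
swap-edge T<g r<k s<k eq = fromNode _ _ T<g T<g r<k s<k s<k r<k eq eq

summed-equation : ∀ {g k r s A a} → k * a + s ≡ A → k * A ≡ a + r * g →
                  k * (A + a) + s ≡ (A + a) + r * g
summed-equation {g} {k} {r} {s} {A} {a} A≡ kA≡ = begin
  k * (A + a) + s      ≡⟨ distribute k A a s ⟩
  k * A + (k * a + s)  ≡⟨ cong₂ _+_ kA≡ A≡ ⟩
  (a + r * g) + A      ≡⟨ rearrange a (r * g) A ⟩
  (A + a) + r * g      ∎
  where
  open ≡-Reasoning
  distribute : ∀ k A a s → k * (A + a) + s ≡ k * A + (k * a + s)
  distribute = solve-∀
  rearrange : ∀ a x A → (a + x) + A ≡ (A + a) + x
  rearrange = solve-∀

overflow-bound : ∀ {g k r T} → g ≤ T → r < k → r * g + T ≤ k * T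
overflow-bound {g} {k} {r} {T} g≤T r<k = begin
  r * g + T  ≤⟨ +-monoˡ-≤ T (*-monoʳ-≤ r g≤T) ⟩
  r * T + T  ≡⟨ +-comm (r * T) T ⟩
  suc r * T  ≤⟨ *-monoˡ-≤ T r<k ⟩
  k * T      ∎
  where open ≤-Reasoning

-- Squeeze: if the bound above is attained and k ≥ 2, g > 0, then g = T.
-- Equality forces (r + 1) T = k T, hence r = k - 1 ≥ 1, and then r g = r T.
squeeze : ∀ {g k r T} → 2 ≤ k → 0 < g → g ≤ T → r < k →
          r * g + T ≡ k * T → g ≡ T
squeeze {g} {k} {r} {T} 2≤k 0<g g≤T r<k tight =
  *-cancelˡ-≡ g T r {{≢-nonZero r≢0}} (+-cancelʳ-≡ T (r * g) (r * T) rg+T≡rT+T)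
  where
  rT+T≤kT : r * T + T ≤ k * T
  rT+T≤kT = subst (_≤ k * T) (+-comm T (r * T)) (*-monoˡ-≤ T r<k)
  rT+T≡kT : r * T + T ≡ k * T
  rT+T≡kT = ≤-antisym rT+T≤kT
              (subst (_≤ r * T + T) tight (+-monoˡ-≤ T (*-monoʳ-≤ r g≤T)))
  rg+T≡rT+T : r * g + T ≡ r * T + T
  rg+T≡rT+T = trans tight (sym rT+T≡kT)
  suc-r≡k : suc r ≡ k
  suc-r≡k = *-cancelʳ-≡ (suc r) k T {{>-nonZero (<-≤-trans 0<g g≤T)}}
              (trans (+-comm T (r * T)) rT+T≡kT)
  r≢0 : r ≢ 0
  r≢0 refl = <-irrefl suc-r≡k 2≤k

overflow-divisor : ∀ {g k r s A a} → 2 ≤ k → 0 < g → r < k →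
                   k * a + s ≡ A → k * A ≡ a + r * g → g ≤ A + a →
                   g ≡ a * (k + 1)
overflow-divisor {g} {k} {r} {s} {A} {a} 2≤k 0<g r<k A≡ kA≡ g≤T = begin
  g          ≡⟨ squeeze 2≤k 0<g g≤T r<k tight ⟩
  A + a      ≡⟨ cong (_+ a) A≡ka ⟩
  k * a + a  ≡⟨ collect k a ⟩
  a * (k + 1) ∎
  where
  open ≡-Reasoning
  collect : ∀ k a → k * a + a ≡ a * (k + 1)
  collect = solve-∀
  rg+T≡kA+A : r * g + (A + a) ≡ k * A + A
  rg+T≡kA+A = trans (regroup (r * g) A a) (cong (_+ A) (sym kA≡))
    where
    regroup : ∀ x A a → x + (A + a) ≡ (a + x) + A
    regroup = solve-∀
  A≤ka : A ≤ k * a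
  A≤ka = +-cancelˡ-≤ (k * A) A (k * a)
           (subst₂ _≤_ rg+T≡kA+A (*-distribˡ-+ k A a) (overflow-bound g≤T r<k))
  s≡0 : s ≡ 0
  s≡0 = n≤0⇒n≡0 (+-cancelˡ-≤ (k * a) s 0
          (subst₂ _≤_ (sym A≡) (sym (+-identityʳ (k * a))) A≤ka))
  A≡ka : A ≡ k * a
  A≡ka = trans (sym A≡) (trans (cong (k * a +_) s≡0) (+-identityʳ (k * a)))
  tight : r * g + (A + a) ≡ k * (A + a)
  tight = trans rg+T≡kA+A
            (trans (cong (k * A +_) A≡ka) (sym (*-distribˡ-+ k A a)))

origin-edge-dichotomy : ∀ {g k r s A a} → 2 ≤ k → 0 < g → r < k → s < k →
                        k * a + s ≡ A → k * A ≡ a + r * g →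
                        Edge g k ⟦ r , s ⟧ ⟦ s , r ⟧ ⊎ g ≡ a * (k + 1)
origin-edge-dichotomy {g} {k} {r} {s} {A} {a} 2≤k 0<g r<k s<k A≡ kA≡ with g ≤? A + a
... | no  g≰T = inj₁ (swap-edge (≰⇒> g≰T) r<k s<k (summed-equation {g} {k} {r} {s} A≡ kA≡))
... | yes g≤T = inj₂ (overflow-divisor 2≤k 0<g r<k A≡ kA≡ g≤T)

lemma3 : (g k : ℕ) → 2 ≤ k → k < g → (r s : ℕ) →
         EdgeY g k ⟦ r , s ⟧ ⟦ 0 , 0 ⟧ → ¬ OddPivot g k ⟦ r , s ⟧ →
         (k + 1) ∣ g
lemma3 g k 2≤k k<g r s (_ , _ , fromNode A a _ _ r<k s<k _ _ e₁ e₂) not-odd =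
  [ (λ odd → ⊥-elim (not-odd odd)) , divides a ]′
    (origin-edge-dichotomy 2≤k 0<g r<k s<k A≡ kA≡)
  where
  0<g : 0 < g
  0<g = <-trans (<-≤-trans z<s 2≤k) k<g
  A≡ : k * a + s ≡ A
  A≡ = trans e₁ (+-identityʳ A)
  kA≡ : k * A ≡ a + r * g
  kA≡ = trans (sym (+-identityʳ (k * A))) e₂
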